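{- Let $N\ge 2$ and let $V_1,\dots,V_N$ be pairwise disjoint finite sets, $V=\bigcup_{i=1}^N V_i$. Let $X\in\{0,1\}^{V\times V}$ be a binary matrix, viewed as an $N\times N$ block matrix whose $(i,j)$ block $X_{ij}\in\{0,1\}^{|V_i|\times|V_j|}$ has rows indexed by $V_i$ and columns indexed by $V_j$. Suppose that (1) $X\succeq 0$ (i.e. $X$ is symmetric positive semidefinite); (2) $X_{ii}=I_{|V_i|}$ for all $1\le i\le N$; (3) $X_{ij}\mathbf{1}\le\mathbf{1}$ and $X_{ij}^{T}\mathbf{1}\le\mathbf{1}$ (entrywise) for all $1\le i<j\le N$, where $\mathbf{1}$ denotes the all-ones vector of appropriate size. Then $X$ encodes a feasible one-to-one global alignment of $V_1,\dots,V_N$ satisfying cycle consistency. Precisely: there is a partition $V=A_1\cup\cdots\cup A_K$ into pairwise disjoint nonempty sets, each containing at most one element of each $V_i$, such that for all $i\neq j$, $u\in V_i$, $v\in V_j$ we have $X_{ij}(u,v)=1$ if and only if $u$ and $v$ lie in the same set $A_k$. In particular, for any $u\in V_i$, $v\in V_j$, $w\in V_k$ with $i,j,k$ distinct, $X_{ij}(u,v)=X_{jk}(v,w)=1$ implies $X_{ik}(u,w)=1$; and $X=YY^{T}$, where $Y\in\{0,1\}^{V\times K}$ is given by $Y(v,k)=1$ iff $v\in A_k$.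
   Context: A one-to-one global alignment of $N$ networks with vertex sets $V_1,\dots,V_N$ is a partition of $\bigcup_i V_i$ into disjoint clusters, each containing at most one vertex from each $V_i$; vertices in the same cluster are said to be aligned. Such an alignment is (cycle) consistent if whenever $v_i$ is aligned to $v_j$ and $v_j$ is aligned to $v_k$ (vertices from three different networks), $v_i$ is aligned to $v_k$. -}

module Defs where

open import Data.Nat using (ℕ; zero; suc; _+_; _≤_; _<_)
open import Data.Fin using (Fin; zero; suc; _≟_)
open import Data.Bool using (Bool; true; false; if_then_else_)
open import Data.Rational using (ℚ; 0ℚ; 1ℚ) renaming (_+_ to _+ℚ_; _*_ to _*ℚ_; _≤_ to _≤ℚ_)
open import Data.Product using (Σ; ∃; _×_)
open import Relation.Nullary.Decidable using (⌊_⌋)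
open import Relation.Binary.PropositionalEquality using (_≡_)

sumℕ : ∀ {n} → (Fin n → ℕ) → ℕ
sumℕ {zero}  f = 0
sumℕ {suc n} f = f zero + sumℕ (λ i → f (suc i))

sumℚ : ∀ {n} → (Fin n → ℚ) → ℚ
sumℚ {zero}  f = 0ℚ
sumℚ {suc n} f = f zero +ℚ sumℚ (λ i → f (suc i))

bℕ : Bool → ℕ
bℕ true  = 1
bℕ false = 0

bℚ : Bool → ℚ
bℚ true  = 1ℚ
bℚ false = 0ℚ

-- Setting: V = Fin n (the disjoint union of V_1..V_N), and
-- net : Fin n → Fin N assigns to each vertex the network it lies in,
-- so V_i = { v | net v ≡ i }.

Symmetric : ∀ {n} → (Fin n → Fin n → Bool) → Set
Symmetric X = ∀ u v → X u v ≡ X v u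

PSD : ∀ {n} → (Fin n → Fin n → Bool) → Set
PSD {n} X = (x : Fin n → ℚ) →
  0ℚ ≤ℚ sumℚ (λ u → sumℚ (λ v → x u *ℚ (bℚ (X u v) *ℚ x v)))

rowSum : ∀ {n N} → (Fin n → Fin N) → (Fin n → Fin n → Bool) → Fin n → Fin N → ℕ
rowSum net X u j = sumℕ (λ v → if ⌊ net v ≟ j ⌋ then bℕ (X u v) else 0)

colSum : ∀ {n N} → (Fin n → Fin N) → (Fin n → Fin n → Bool) → Fin N → Fin n → ℕ
colSum net X i v = sumℕ (λ u → if ⌊ net u ≟ i ⌋ then bℕ (X u v) else 0)

-- A 0/1 matrix that is positive semidefinite with unit diagonal is the indicator
-- matrix of an equivalence relation.  Reflexivity and symmetry are given; for
-- transitivity, if X u v = X v w = 1 but X u w = 0 then the principal submatrix on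
-- u, v, w is [[1,1,0],[1,1,1],[0,1,1]], and x = e_u − e_v + e_w gives xᵀ X x = −1.
-- The clusters are the equivalence classes, and X_ii = I says that two distinct
-- vertices of one network are never equivalent.
module Submission where

open import Defs
open import Data.Nat using (ℕ; zero; suc; _≤_)
open import Data.Fin using (Fin; zero; suc) renaming (_<_ to _<ᶠ_)
open import Data.Fin.Properties using (any?; suc-injective)
open import Data.Bool using (Bool; true; false)
import Data.Bool as Bool
open import Data.Rational using (ℚ; 0ℚ; 1ℚ; _+_; _-_; _*_; -_; *≤*) renaming (_≤_ to _≤ℚ_)
open import Data.Rational.Properties using (*-zeroˡ; *-identityˡ; +-identityˡ; +-identityʳ; neg-distrib-+)
open import Data.Rational.Solver using (module +-*-Solver)
open import Data.Product using (Σ; ∃; _×_; _,_)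
open import Data.Empty using (⊥-elim)
open import Function.Bundles using (_⇔_; mk⇔; Equivalence)
open import Function.Construct.Composition using (_⇔-∘_)
open import Relation.Nullary using (¬_; yes; no)
open import Relation.Binary.Core using (Rel)
open import Relation.Binary.Definitions using (Decidable)
open import Relation.Binary.Structures using (IsEquivalence)
import Relation.Binary.Construct.On as On
open import Relation.Binary.PropositionalEquality
  using (_≡_; refl; trans; cong; cong₂; subst; module ≡-Reasoning)
  renaming (sym to ≡-sym)

record FinQuotient {n ℓ} (R : Rel (Fin n) ℓ) : Set ℓ where
  field
    size              : ℕ
    class             : Fin n → Fin size
    class-surjective  : ∀ k → ∃ λ v → class v ≡ k
    related⇔sameClass : ∀ u v → R u v ⇔ (class u ≡ class v)

finQuotient : ∀ {n ℓ} {R : Rel (Fin n) ℓ} →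
  IsEquivalence R → Decidable R → FinQuotient R
finQuotient {zero} _ _ = record
  { size = 0 ; class = λ () ; class-surjective = λ () ; related⇔sameClass = λ () }
finQuotient {suc n} {R = R} isEq dec
  with finQuotient (On.isEquivalence suc isEq) (λ i j → dec (suc i) (suc j))
     | any? (λ i → dec zero (suc i))
... | Q | yes (v , R0v) = record
  { size = size
  ; class = λ u → class (rep u)
  ; class-surjective = λ k → let w , e = class-surjective k in suc w , e
  ; related⇔sameClass = λ u w → related⇔sameClass (rep u) (rep w) ⇔-∘ viaRep u w
  }
  where
  open FinQuotient Q
  open IsEquivalence isEq renaming (refl to R-refl; sym to R-sym; trans to R-trans)
  rep : Fin (suc n) → Fin n
  rep zero    = v
  rep (suc i) = i
  toRep : ∀ u → R u (suc (rep u))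
  toRep zero    = R0v
  toRep (suc i) = R-refl
  viaRep : ∀ u w → R u w ⇔ R (suc (rep u)) (suc (rep w))
  viaRep u w = mk⇔ (λ r → R-trans (R-sym (toRep u)) (R-trans r (toRep w)))
                   (λ r → R-trans (toRep u) (R-trans r (R-sym (toRep w))))
... | Q | no ¬R0 = record
  { size = suc size
  ; class = class′
  ; class-surjective = surjective
  ; related⇔sameClass = equivalent
  }
  where
  open FinQuotient Q
  open IsEquivalence isEq using () renaming (refl to R-refl; sym to R-sym)
  class′ : Fin (suc n) → Fin (suc size)
  class′ zero    = zero
  class′ (suc i) = suc (class i)
  surjective : ∀ k → ∃ λ v → class′ v ≡ k
  surjective zero    = zero , refl
  surjective (suc k) = let w , e = class-surjective k in suc w , cong suc e
  equivalent : ∀ u w → R u w ⇔ (class′ u ≡ class′ w)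
  equivalent zero    zero    = mk⇔ (λ _ → refl) (λ _ → R-refl)
  equivalent zero    (suc j) = mk⇔ (λ r → ⊥-elim (¬R0 (j , r))) (λ ())
  equivalent (suc i) zero    = mk⇔ (λ r → ⊥-elim (¬R0 (i , R-sym r))) (λ ())
  equivalent (suc i) (suc j) =
    mk⇔ (cong suc) suc-injective ⇔-∘ related⇔sameClass i j

basis : ∀ {n} → Fin n → Fin n → ℚ
basis zero    zero    = 1ℚ
basis zero    (suc _) = 0ℚ
basis (suc _) zero    = 0ℚ
basis (suc a) (suc i) = basis a i

sumℚ-cong : ∀ {n} {f g : Fin n → ℚ} → (∀ i → f i ≡ g i) → sumℚ f ≡ sumℚ g
sumℚ-cong {zero}  _ = refl
sumℚ-cong {suc n} e = cong₂ _+_ (e zero) (sumℚ-cong (λ i → e (suc i)))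

sumℚ-+ : ∀ {n} (f g : Fin n → ℚ) → sumℚ (λ i → f i + g i) ≡ sumℚ f + sumℚ g
sumℚ-+ {zero}  _ _ = refl
sumℚ-+ {suc n} f g = begin
  (f zero + g zero) + sumℚ (λ i → f (suc i) + g (suc i))
    ≡⟨ cong ((f zero + g zero) +_) (sumℚ-+ (λ i → f (suc i)) (λ i → g (suc i))) ⟩
  (f zero + g zero) + (sumℚ (λ i → f (suc i)) + sumℚ (λ i → g (suc i)))
    ≡⟨ solve 4 (λ a b c d → (a :+ b) :+ (c :+ d) := (a :+ c) :+ (b :+ d)) refl
         (f zero) (g zero) (sumℚ (λ i → f (suc i))) (sumℚ (λ i → g (suc i))) ⟩
  (f zero + sumℚ (λ i → f (suc i))) + (g zero + sumℚ (λ i → g (suc i))) ∎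
  where open ≡-Reasoning; open +-*-Solver

sumℚ-neg : ∀ {n} (f : Fin n → ℚ) → sumℚ (λ i → - f i) ≡ - sumℚ f
sumℚ-neg {zero}  _ = refl
sumℚ-neg {suc n} f = begin
  - f zero + sumℚ (λ i → - f (suc i)) ≡⟨ cong (- f zero +_) (sumℚ-neg (λ i → f (suc i))) ⟩
  - f zero + - sumℚ (λ i → f (suc i)) ≡⟨ ≡-sym (neg-distrib-+ (f zero) _) ⟩
  - sumℚ f                             ∎
  where open ≡-Reasoning

sumℚ-zero* : ∀ {n} (f : Fin n → ℚ) → sumℚ (λ i → 0ℚ * f i) ≡ 0ℚ
sumℚ-zero* {zero}  _ = refl
sumℚ-zero* {suc n} f = cong₂ _+_ (*-zeroˡ (f zero)) (sumℚ-zero* (λ i → f (suc i)))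

sumℚ-basis* : ∀ {n} (a : Fin n) (f : Fin n → ℚ) → sumℚ (λ i → basis a i * f i) ≡ f a
sumℚ-basis* zero f = begin
  1ℚ * f zero + sumℚ (λ i → 0ℚ * f (suc i))
    ≡⟨ cong₂ _+_ (*-identityˡ (f zero)) (sumℚ-zero* (λ i → f (suc i))) ⟩
  f zero + 0ℚ ≡⟨ +-identityʳ (f zero) ⟩
  f zero ∎
  where open ≡-Reasoning
sumℚ-basis* (suc a) f = begin
  0ℚ * f zero + sumℚ (λ i → basis a i * f (suc i))
    ≡⟨ cong₂ _+_ (*-zeroˡ (f zero)) (sumℚ-basis* a (λ i → f (suc i))) ⟩
  0ℚ + f (suc a) ≡⟨ +-identityˡ _ ⟩
  f (suc a) ∎
  where open ≡-Reasoning

alternatingBasis : ∀ {n} → Fin n → Fin n → Fin n → Fin n → ℚ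
alternatingBasis a b c i = basis a i - basis b i + basis c i

sumℚ-alternatingBasis* : ∀ {n} (a b c : Fin n) (f : Fin n → ℚ) →
  sumℚ (λ i → alternatingBasis a b c i * f i) ≡ f a - f b + f c
sumℚ-alternatingBasis* {n} a b c f = begin
  sumℚ (λ i → alternatingBasis a b c i * f i)
    ≡⟨ sumℚ-cong (λ i → solve 4 (λ p q r y → (p :- q :+ r) :* y := (p :* y :+ :- (q :* y)) :+ r :* y)
         refl (basis a i) (basis b i) (basis c i) (f i)) ⟩
  sumℚ (λ i → (fa i + - fb i) + fc i)
    ≡⟨ sumℚ-+ (λ i → fa i + - fb i) fc ⟩
  sumℚ (λ i → fa i + - fb i) + sumℚ fc
    ≡⟨ cong (_+ sumℚ fc) (sumℚ-+ fa (λ i → - fb i)) ⟩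
  sumℚ fa + sumℚ (λ i → - fb i) + sumℚ fc
    ≡⟨ cong (λ t → sumℚ fa + t + sumℚ fc) (sumℚ-neg fb) ⟩
  sumℚ fa - sumℚ fb + sumℚ fc
    ≡⟨ cong₂ _+_ (cong₂ _-_ (sumℚ-basis* a f) (sumℚ-basis* b f)) (sumℚ-basis* c f) ⟩
  f a - f b + f c ∎
  where
  open ≡-Reasoning
  open +-*-Solver
  fa fb fc : Fin n → ℚ
  fa i = basis a i * f i
  fb i = basis b i * f i
  fc i = basis c i * f i

quadraticForm : ∀ {n} → (Fin n → Fin n → ℚ) → (Fin n → ℚ) → ℚ
quadraticForm M x = sumℚ λ u → sumℚ λ v → x u * (M u v * x v)

quadraticForm-alternatingBasis : ∀ {n} (M : Fin n → Fin n → ℚ) (a b c : Fin n) →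
  let row : Fin n → ℚ
      row u = M u a - M u b + M u c
  in quadraticForm M (alternatingBasis a b c) ≡ row a - row b + row c
quadraticForm-alternatingBasis {n} M a b c = begin
  sumℚ (λ u → sumℚ (λ v → x u * (M u v * x v)))
    ≡⟨ sumℚ-cong inner ⟩
  sumℚ (λ u → x u * row u)
    ≡⟨ sumℚ-alternatingBasis* a b c row ⟩
  row a - row b + row c ∎
  where
  open ≡-Reasoning
  open +-*-Solver
  x : Fin n → ℚ
  x = alternatingBasis a b c
  row : Fin n → ℚ
  row u = M u a - M u b + M u c
  inner : ∀ u → sumℚ (λ v → x u * (M u v * x v)) ≡ x u * row u
  inner u = begin
    sumℚ (λ v → x u * (M u v * x v))
      ≡⟨ sumℚ-cong (λ v → solve 3 (λ s m y → s :* (m :* y) := y :* (s :* m)) refl (x u) (M u v) (x v)) ⟩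
    sumℚ (λ v → x v * (x u * M u v))
      ≡⟨ sumℚ-alternatingBasis* a b c (λ v → x u * M u v) ⟩
    x u * M u a - x u * M u b + x u * M u c
      ≡⟨ solve 4 (λ s p q r → s :* p :- s :* q :+ s :* r := s :* (p :- q :+ r)) refl
           (x u) (M u a) (M u b) (M u c) ⟩
    x u * row u ∎

psd⇒transitive : ∀ {n} (X : Fin n → Fin n → Bool) → Symmetric X → PSD X →
  (∀ u → X u u ≡ true) →
  ∀ {u v w} → X u v ≡ true → X v w ≡ true → X u w ≡ true
psd⇒transitive {n} X symmetric psd diagonal {u} {v} {w} Xuv Xvw with X u w in Xuw
... | true  = refl
... | false = ⊥-elim (negative (subst (0ℚ ≤ℚ_) value (psd (alternatingBasis u v w))))
  where
  M : Fin n → Fin n → ℚ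
  M a b = bℚ (X a b)
  row≡ : ∀ a {p q r} → X a u ≡ p → X a v ≡ q → X a w ≡ r →
    M a u - M a v + M a w ≡ bℚ p - bℚ q + bℚ r
  row≡ a p q r = cong₂ _+_ (cong₂ _-_ (cong bℚ p) (cong bℚ q)) (cong bℚ r)
  flipped : ∀ {a b c} → X a b ≡ c → X b a ≡ c
  flipped {a} {b} = subst (_≡ _) (symmetric a b)
  value : quadraticForm M (alternatingBasis u v w) ≡
    (1ℚ - 1ℚ + 0ℚ) - (1ℚ - 1ℚ + 1ℚ) + (0ℚ - 1ℚ + 1ℚ)
  value = trans (quadraticForm-alternatingBasis M u v w)
    (cong₂ _+_ (cong₂ _-_ (row≡ u (diagonal u) Xuv Xuw)
                          (row≡ v (flipped Xuv) (diagonal v) Xvw))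
               (row≡ w (flipped Xuw) (flipped Xvw) (diagonal w)))
  negative : ¬ (0ℚ ≤ℚ (1ℚ - 1ℚ + 0ℚ) - (1ℚ - 1ℚ + 1ℚ) + (0ℚ - 1ℚ + 1ℚ))
  negative (*≤* ())

proposition1 : (N : ℕ) → 2 ≤ N → (n : ℕ) → (net : Fin n → Fin N) →
    (X : Fin n → Fin n → Bool) →
    Symmetric X → PSD X →
    (∀ u v → net u ≡ net v → (X u v ≡ true ⇔ u ≡ v)) →
    (∀ (i j : Fin N) → i <ᶠ j →
      (∀ u → net u ≡ i → rowSum net X u j ≤ 1) ×
      (∀ v → net v ≡ j → colSum net X i v ≤ 1)) →
    Σ ℕ λ K → Σ (Fin n → Fin K) λ A →
      (∀ (k : Fin K) → ∃ λ v → A v ≡ k) ×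
      (∀ u v → A u ≡ A v → net u ≡ net v → u ≡ v) ×
      (∀ u v → ¬ (net u ≡ net v) → (X u v ≡ true ⇔ A u ≡ A v))
proposition1 N _ n net X symmetric psd identityBlocks _ =
  size , class , class-surjective ,
  (λ u v same sameNet →
    Equivalence.to (identityBlocks u v sameNet) (Equivalence.from (related⇔sameClass u v) same)) ,
  (λ u v _ → related⇔sameClass u v)
  where
  diagonal : ∀ u → X u u ≡ true
  diagonal u = Equivalence.from (identityBlocks u u refl) refl
  aligned-isEquivalence : IsEquivalence (λ u v → X u v ≡ true)
  aligned-isEquivalence = record
    { refl  = λ {u} → diagonal u
    ; sym   = λ {u} {v} → subst (_≡ true) (symmetric u v)
    ; trans = psd⇒transitive X symmetric psd diagonal
    }
  open FinQuotient (finQuotient aligned-isEquivalence (λ u v → X u v Bool.≟ true))
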